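{- Let $P$ be a finite poset that is self-dual (there is a poset isomorphism $P\cong P^*$) and regular of valence $\Delta$ (every element has degree $\Delta$ in the Hasse diagram, i.e. the number of elements it covers plus the number of elements covering it is $\Delta$). Then $P$ is mCDE and CDE, with $\mathbb{E}(X)=\mathbb{E}(Y)=\Delta/2$.
   Context: For a finite poset $P$, the down-degree of $p$ is $\#\{q\in P:q\lessdot p\}$. For $m\ge1$, $X^{(m)}$ is the down-degree random variable under the distribution assigning $p$ probability proportional to the number of $m$-element multichains $p_1\le\cdots\le p_m$ passing through $p$; $X=X^{(1)}$ (uniform distribution). $Y$ is the down-degree random variable under the distribution assigning $p$ probability proportional to the number of maximal chains of $P$ containing $p$. $P$ is CDE if $\mathbb{E}(X)=\mathbb{E}(Y)$ and mCDE if $\mathbb{E}(X^{(m)})$ is the same for all $m\ge1$. $P^*$ is the dual poset. -}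

module Defs where

open import Data.Nat using (ℕ; zero; suc; _+_; _*_)
open import Data.Bool using (Bool; true; false; _∧_; _∨_; not; T)
open import Data.Bool.Properties using (T?)
open import Data.Fin using (Fin; zero; suc)
open import Data.Fin.Properties using () renaming (_≟_ to _≟ᶠ_)
open import Data.Vec using (Vec; []; _∷_; lookup)
open import Data.List using (List; []; _∷_; map; concatMap; allFin; length; filter)
open import Data.Bool.ListAction using (all; any)
open import Data.Nat.ListAction using (sum)
open import Data.Integer using (+_)
open import Data.Rational using (ℚ; _/_; 0ℚ)
open import Relation.Nullary.Decidable using (⌊_⌋)
open import Relation.Binary.PropositionalEquality using (_≡_)
open import Function.Bundles using (_↔_; Inverse)
open import Data.Product using (_×_; Σ)

record FinPoset (n : ℕ) : Set where
  field
    le      : Fin n → Fin n → Bool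
    refl    : ∀ x → T (le x x)
    antisym : ∀ x y → T (le x y) → T (le y x) → x ≡ y
    trans   : ∀ x y z → T (le x y) → T (le y z) → T (le x z)

allVecs : {A : Set} → List A → (m : ℕ) → List (Vec A m)
allVecs xs zero    = [] ∷ []
allVecs xs (suc m) = concatMap (λ x → map (x ∷_) (allVecs xs m)) xs

sumFin : (n : ℕ) → (Fin n → ℕ) → ℕ
sumFin n f = sum (map f (allFin n))

-- a / b as a rational (b = 0 never occurs below for nonempty P; set to 0)
ratio : ℕ → ℕ → ℚ
ratio a zero    = 0ℚ
ratio a (suc b) = + a / suc b

module _ {n : ℕ} (P : FinPoset n) where
  open FinPoset P

  eqᵇ : Fin n → Fin n → Bool
  eqᵇ x y = ⌊ x ≟ᶠ y ⌋

  ltᵇ : Fin n → Fin n → Bool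
  ltᵇ x y = le x y ∧ not (eqᵇ x y)

  coversᵇ : Fin n → Fin n → Bool
  coversᵇ q p = ltᵇ q p ∧ not (any (λ r → ltᵇ q r ∧ ltᵇ r p) (allFin n))

  countᵇ : (Fin n → Bool) → ℕ
  countᵇ f = length (filter (λ x → T? (f x)) (allFin n))

  downDeg : Fin n → ℕ
  downDeg p = countᵇ (λ q → coversᵇ q p)

  upDeg : Fin n → ℕ
  upDeg p = countᵇ (λ q → coversᵇ p q)

  hasseDeg : Fin n → ℕ
  hasseDeg p = downDeg p + upDeg p

  Regular : ℕ → Set
  Regular Δ = ∀ p → hasseDeg p ≡ Δ

  isMultichain : {m : ℕ} → Vec (Fin n) m → Bool
  isMultichain []           = true
  isMultichain (x ∷ [])     = true
  isMultichain (x ∷ y ∷ xs) = le x y ∧ isMultichain (y ∷ xs)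

  vecHas : {m : ℕ} → Fin n → Vec (Fin n) m → Bool
  vecHas p []       = false
  vecHas p (x ∷ xs) = eqᵇ p x ∨ vecHas p xs

  multichainWeight : ℕ → Fin n → ℕ
  multichainWeight m p =
    length (filter (λ v → T? (isMultichain v ∧ vecHas p v)) (allVecs (allFin n) m))

  Sub : Set
  Sub = Vec Bool n

  mem : Fin n → Sub → Bool
  mem x s = lookup s x

  allSubs : List Sub
  allSubs = allVecs (true ∷ false ∷ []) n

  subsetᵇ : Sub → Sub → Bool
  subsetᵇ s t = all (λ x → not (mem x s) ∨ mem x t) (allFin n)

  isChain : Sub → Bool
  isChain s = all (λ x → all (λ y →
                not (mem x s ∧ mem y s) ∨ (le x y ∨ le y x)) (allFin n)) (allFin n)

  isMaximalChain : Sub → Bool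
  isMaximalChain s = isChain s ∧
    all (λ t → not (subsetᵇ s t ∧ isChain t) ∨ subsetᵇ t s) allSubs

  maxChainWeight : Fin n → ℕ
  maxChainWeight p = length (filter (λ s → T? (isMaximalChain s ∧ mem p s)) allSubs)

  -- Expectations of the down-degree under a weight w (Pr(p) ∝ w p)

  expectation : (Fin n → ℕ) → ℚ
  expectation w = ratio (sumFin n (λ p → w p * downDeg p)) (sumFin n w)

  EXm : ℕ → ℚ
  EXm m = expectation (multichainWeight m)

  -- 𝔼(X) = 𝔼(X^(1)) (uniform distribution)
  EX : ℚ
  EX = EXm 1

  EY : ℚ
  EY = expectation maxChainWeight

  CDE : Set
  CDE = EX ≡ EY

  mCDE : Set
  mCDE = ∀ m m' → EXm (suc m) ≡ EXm (suc m')

  SelfDual : Set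
  SelfDual = Σ (Fin n ↔ Fin n) λ φ →
    ∀ x y → le x y ≡ le (Inverse.to φ y) (Inverse.to φ x)

-- A self-duality φ : P ≅ P* sends the elements covered by φ p to the elements covering p,
-- so downDeg ∘ φ = upDeg.  Reversing and transporting a multichain (resp. taking the
-- image of a maximal chain) under φ is a bijection, so every weight w in the definition
-- of 𝔼(X^(m)) and 𝔼(Y) satisfies w ∘ φ = w.  Reindexing by φ then shows that the
-- w-weighted sums of down-degrees and of up-degrees agree; their sum is Δ · Σ w by
-- regularity, so every such expectation equals Δ/2.

module Submission where

open import Defs
open import Algebra.Properties.CommutativeSemigroup using (interchange)
open import Data.Bool using (Bool; true; false; _∧_; _∨_; not; T; if_then_else_)
open import Data.Bool.ListAction using (all; any)
open import Data.Bool.Properties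
  using ( T?; T-∧; T-∨; T-≡; ∧-isCommutativeMonoid; ∨-isCommutativeMonoid
        ; ∧-comm; ∨-comm; ∨-assoc; ∧-assoc; ∧-identityʳ )
open import Data.Empty using (⊥-elim)
open import Data.Fin using (Fin; zero; suc)
open import Data.Fin.Properties using () renaming (_≟_ to _≟ᶠ_)
import Data.Fin.Subset as Subset
open Subset using (⁅_⁆; ∣_∣)
open import Data.Fin.Subset.Properties using (p⊂q⇒∣p∣<∣q∣; x∈⁅x⁆; x∈⁅y⁆⇒x≡y)
open import Data.Integer using (+_)
open import Data.Integer.Properties using (pos-*)
open import Data.List
  using (List; []; _∷_; map; concatMap; allFin; length; filter; _++_; cartesianProductWith; foldr)
open import Data.List.Extrema.Nat using (argmax; f[⊥]≤f[argmax]; f[xs]≤f[argmax])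
open import Data.List.Membership.Propositional using (_∈_; lose)
open import Data.List.Membership.Propositional.Properties
  using (∈-allFin; ∈-map⁺; ∈-cartesianProductWith⁺)
open import Data.List.Membership.Propositional.Properties.WithK using (unique∧set⇒bag)
open import Data.List.Relation.Binary.BagAndSetEquality using (∼bag⇒↭)
open import Data.List.Relation.Binary.Permutation.Propositional using (_↭_; ↭⇒↭ₛ)
open import Data.List.Relation.Binary.Permutation.Propositional.Properties
  using (map⁺; filter-↭; ↭-length)
import Data.List.Relation.Binary.Permutation.Setoid.Properties as Perm
open import Data.List.Relation.Unary.All as All using (All; []; _∷_)
open import Data.List.Relation.Unary.All.Properties using (all⁺; all⁻)
open import Data.List.Relation.Unary.Any using (here; there)
open import Data.List.Relation.Unary.AllPairs using ([]; _∷_)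
open import Data.List.Relation.Unary.Unique.Propositional using (Unique)
import Data.List.Relation.Unary.Unique.Propositional.Properties as Unique
open import Data.List.Properties using (map-∘; map-cong; filter-some; filter-≐)
open import Data.Nat using (ℕ; zero; suc; _+_; _*_; _≤_; _<_; z≤n; s≤s)
open import Data.Nat.ListAction using (sum)
open import Data.Nat.ListAction.Properties using (sum-↭)
open import Data.Nat.Properties
  using ( module ≤-Reasoning; +-commutativeSemigroup; *-comm; *-distribʳ-+; *-distribˡ-+
        ; +-identityʳ; m≤m+n; m≤n+m; ≤-trans; <⇒≱ )
open import Data.Product using (Σ; _×_; _,_; proj₁; proj₂)
open import Data.Sum using (inj₁)
open import Data.Rational using (_/_)
open import Data.Rational.Properties using (fromℚᵘ-cong)
open import Data.Rational.Unnormalised using (mkℚᵘ; *≡*)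
open import Data.Vec using (Vec; []; _∷_; _∷ʳ_; reverse; replicate; tabulate; lookup)
import Data.Vec as Vec
open import Data.Vec.Properties
  using ( ∷-injective; reverse-∷; reverse-involutive; lookup∘tabulate; tabulate-cong; tabulate∘lookup
        ; []=⇒lookup; lookup⇒[]= )
import Data.Vec.Properties as Vecₚ
open import Function using (_∘_)
open import Function.Bundles using (_↔_; Inverse; Injection; Equivalence; mk↔ₛ′; mk⇔)
open import Function.Construct.Composition using (_↔-∘_)
open import Function.Properties.Inverse using (↔⇒↣)
open import Relation.Binary.PropositionalEquality
open import Relation.Nullary using (Dec; yes; no; contradiction)
open import Relation.Nullary.Decidable using (⌊_⌋; fromWitness)

module _ {A : Set} where

  ≤-sum-map : (f : A → ℕ) {x : A} {xs : List A} → x ∈ xs → f x ≤ sum (map f xs)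
  ≤-sum-map f (here refl)             = m≤m+n _ _
  ≤-sum-map f {xs = y ∷ _} (there x∈) = ≤-trans (≤-sum-map f x∈) (m≤n+m _ (f y))

  sum-map-+ : (f g : A → ℕ) (xs : List A) →
              sum (map (λ x → f x + g x) xs) ≡ sum (map f xs) + sum (map g xs)
  sum-map-+ f g []       = refl
  sum-map-+ f g (x ∷ xs) = trans (cong (_+_ (f x + g x)) (sum-map-+ f g xs))
                                 (interchange +-commutativeSemigroup (f x) (g x) _ _)

  sum-map-*ʳ : (f : A → ℕ) (c : ℕ) (xs : List A) →
               sum (map (λ x → f x * c) xs) ≡ sum (map f xs) * c
  sum-map-*ʳ f c []       = refl
  sum-map-*ʳ f c (x ∷ xs) = trans (cong (_+_ (f x * c)) (sum-map-*ʳ f c xs))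
                                  (sym (*-distribʳ-+ c (f x) _))

  count-cong : {Q Q′ : A → Bool} (xs : List A) → (∀ x → Q x ≡ Q′ x) →
               length (filter (T? ∘ Q) xs) ≡ length (filter (T? ∘ Q′) xs)
  count-cong {Q} {Q′} xs eq = cong length (filter-≐ (T? ∘ Q) (T? ∘ Q′) (Q⊆Q′ , Q′⊆Q) xs)
    where
      Q⊆Q′ : ∀ {x} → T (Q x) → T (Q′ x)
      Q⊆Q′ {x} = subst T (eq x)
      Q′⊆Q : ∀ {x} → T (Q′ x) → T (Q x)
      Q′⊆Q {x} = subst T (sym (eq x))

  all-cong : {Q Q′ : A → Bool} (xs : List A) → (∀ x → Q x ≡ Q′ x) →
             all Q xs ≡ all Q′ xs
  all-cong xs eq = cong (foldr _∧_ true) (map-cong eq xs)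

  any-cong : {Q Q′ : A → Bool} (xs : List A) → (∀ x → Q x ≡ Q′ x) →
             any Q xs ≡ any Q′ xs
  any-cong xs eq = cong (foldr _∨_ false) (map-cong eq xs)

module _ {A B : Set} where

  length-filter-map : (Q : B → Bool) (g : A → B) (xs : List A) →
    length (filter (T? ∘ Q) (map g xs)) ≡ length (filter (T? ∘ Q ∘ g) xs)
  length-filter-map Q g []       = refl
  length-filter-map Q g (x ∷ xs) with Q (g x)
  ... | true  = cong suc (length-filter-map Q g xs)
  ... | false = length-filter-map Q g xs

concatMap-map≡cartesianProductWith : {A B C : Set} (f : A → B → C) (xs : List A) (ys : List B) →
  concatMap (λ x → map (f x) ys) xs ≡ cartesianProductWith f xs ys
concatMap-map≡cartesianProductWith f []       ys = refl
concatMap-map≡cartesianProductWith f (x ∷ xs) ys =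
  cong (map (f x) ys ++_) (concatMap-map≡cartesianProductWith f xs ys)

isYes-⇔ : {A B : Set} → (A → B) → (B → A) → (a? : Dec A) (b? : Dec B) →
          ⌊ a? ⌋ ≡ ⌊ b? ⌋
isYes-⇔ f g (yes a) (yes b) = refl
isYes-⇔ f g (yes a) (no ¬b) = contradiction (f a) ¬b
isYes-⇔ f g (no ¬a) (yes b) = contradiction (g b) ¬a
isYes-⇔ f g (no ¬a) (no ¬b) = refl

module _ {A : Set} (Q : A → Bool) where

  T-all-intro : (xs : List A) → (∀ x → T (Q x)) → T (all Q xs)
  T-all-intro xs h = all⁻ Q {xs} (All.tabulate (λ {x} _ → h x))

  T-all-elim : {xs : List A} → T (all Q xs) → {x : A} → x ∈ xs → T (Q x)
  T-all-elim {xs} t = All.lookup (all⁺ Q xs t)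

T-∧-intro : {a b : Bool} → T a → T b → T (a ∧ b)
T-∧-intro ta tb = Equivalence.from T-∧ (ta , tb)

T-⇒-intro : {a b : Bool} → (T a → T b) → T (not a ∨ b)
T-⇒-intro {false} _ = _
T-⇒-intro {true}  f = f _

T-⇒-elim : {a b : Bool} → T (not a ∨ b) → T a → T b
T-⇒-elim {true} tb _ = tb

record IsEnumeration {A : Set} (xs : List A) : Set where
  field
    unique   : Unique xs
    complete : ∀ x → x ∈ xs

allFin-isEnumeration : (n : ℕ) → IsEnumeration (allFin n)
allFin-isEnumeration n = record { unique = Unique.allFin⁺ n ; complete = ∈-allFin }

bools-isEnumeration : IsEnumeration (true ∷ false ∷ [])
bools-isEnumeration = record
  { unique   = ((λ ()) ∷ []) ∷ [] ∷ []
  ; complete = λ { true → here refl ; false → there (here refl) }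
  }

allVecs-isEnumeration : {A : Set} {xs : List A} → IsEnumeration xs → (m : ℕ) →
                        IsEnumeration (allVecs xs m)
allVecs-isEnumeration enum zero = record
  { unique   = [] ∷ []
  ; complete = λ { [] → here refl }
  }
allVecs-isEnumeration {xs = xs} enum (suc m) = record
  { unique   = subst Unique (sym allVecs-suc)
                 (Unique.cartesianProductWith⁺ _∷_ ∷-injective unique (IsEnumeration.unique rest))
  ; complete = λ { (y ∷ v) → subst ((y ∷ v) ∈_) (sym allVecs-suc)
                   (∈-cartesianProductWith⁺ _∷_ (complete y) (IsEnumeration.complete rest v)) }
  }
  where
    open IsEnumeration enum
    rest : IsEnumeration (allVecs xs m)
    rest = allVecs-isEnumeration enum m
    allVecs-suc : allVecs xs (suc m) ≡ cartesianProductWith _∷_ xs (allVecs xs m)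
    allVecs-suc = concatMap-map≡cartesianProductWith _∷_ xs (allVecs xs m)

module Reindex {A : Set} {xs : List A} (enum : IsEnumeration xs) (g : A ↔ A) where
  open IsEnumeration enum
  open Inverse g using (to; from; strictlyInverseˡ)

  map-to-↭ : map to xs ↭ xs
  map-to-↭ = ∼bag⇒↭ (unique∧set⇒bag (Unique.map⁺ (Injection.injective (↔⇒↣ g)) unique) unique
                       (λ {x} → mk⇔ (λ _ → complete x) (λ _ → ∈-map-to x)))
    where
      ∈-map-to : ∀ x → x ∈ map to xs
      ∈-map-to x = subst (_∈ map to xs) (strictlyInverseˡ x) (∈-map⁺ to (complete (from x)))

  sum-map-∘-to : (f : A → ℕ) → sum (map (f ∘ to) xs) ≡ sum (map f xs)
  sum-map-∘-to f = trans (cong sum (map-∘ xs)) (sum-↭ (map⁺ f map-to-↭))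

  count-∘-to : (Q : A → Bool) →
               length (filter (T? ∘ Q ∘ to) xs) ≡ length (filter (T? ∘ Q) xs)
  count-∘-to Q =
    trans (sym (length-filter-map Q to xs)) (↭-length (filter-↭ (T? ∘ Q) map-to-↭))

  any-∘-to : (Q : A → Bool) → any (Q ∘ to) xs ≡ any Q xs
  any-∘-to Q = trans (cong (foldr _∨_ false) (map-∘ xs))
    (Perm.foldr-commMonoid (setoid Bool) ∨-isCommutativeMonoid (↭⇒↭ₛ (map⁺ Q map-to-↭)))

  all-∘-to : (Q : A → Bool) → all (Q ∘ to) xs ≡ all Q xs
  all-∘-to Q = trans (cong (foldr _∧_ true) (map-∘ xs))
    (Perm.foldr-commMonoid (setoid Bool) ∧-isCommutativeMonoid (↭⇒↭ₛ (map⁺ Q map-to-↭)))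

reverse↔ : {A : Set} {m : ℕ} → Vec A m ↔ Vec A m
reverse↔ = mk↔ₛ′ reverse reverse reverse-involutive reverse-involutive

map↔ : {A B : Set} {m : ℕ} → A ↔ B → Vec A m ↔ Vec B m
map↔ g = mk↔ₛ′ (Vec.map to) (Vec.map from)
               (map-inverse strictlyInverseˡ) (map-inverse strictlyInverseʳ)
  where
    open Inverse g
    map-inverse : {C D : Set} {f : C → D} {h : D → C} → (∀ y → f (h y) ≡ y) →
                  ∀ {m} (v : Vec D m) → Vec.map f (Vec.map h v) ≡ v
    map-inverse {f = f} {h} inv v =
      trans (sym (Vecₚ.map-∘ f h v)) (trans (Vecₚ.map-cong inv v) (Vecₚ.map-id v))

permute↔ : {A : Set} {n : ℕ} → Fin n ↔ Fin n → Vec A n ↔ Vec A n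
permute↔ σ = mk↔ₛ′ (precompose from) (precompose to)
  (λ s → precompose-inverse strictlyInverseˡ s) (λ s → precompose-inverse strictlyInverseʳ s)
  where
    open Inverse σ
    precompose : {A : Set} {n : ℕ} → (Fin n → Fin n) → Vec A n → Vec A n
    precompose f s = tabulate (lookup s ∘ f)
    precompose-inverse : {A : Set} {n : ℕ} {f h : Fin n → Fin n} → (∀ x → h (f x) ≡ x) →
                         (s : Vec A n) → precompose f (precompose h s) ≡ s
    precompose-inverse {f = f} {h} inv s = trans (tabulate-cong entry) (tabulate∘lookup s)
      where
        entry : ∀ x → lookup (precompose h s) (f x) ≡ lookup s x
        entry x = trans (lookup∘tabulate (lookup s ∘ h) (f x)) (cong (lookup s) (inv x))

lookup-permute : {A : Set} {n : ℕ} (σ : Fin n ↔ Fin n) (s : Vec A n) (x : Fin n) →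
                 lookup (Inverse.to (permute↔ σ) s) (Inverse.to σ x) ≡ lookup s x
lookup-permute σ s x = trans (lookup∘tabulate _ (to x)) (cong (lookup s) (strictlyInverseʳ x))
  where open Inverse σ

ratio≡/ : (a b c d : ℕ) → a * suc d ≡ c * b → 0 < b → ratio a b ≡ + c / suc d
ratio≡/ a (suc b) c d eq _ =
  fromℚᵘ-cong {mkℚᵘ (+ a) b} {mkℚᵘ (+ c) d}
    (*≡* (trans (sym (pos-* a (suc d))) (trans (cong +_ eq) (pos-* c (suc b)))))

sumFin-pos : {n : ℕ} (w : Fin n → ℕ) (p : Fin n) → 0 < w p → 0 < sumFin n w
sumFin-pos w p 0<wp = ≤-trans 0<wp (≤-sum-map w (∈-allFin p))

∈⇒T-lookup : {n : ℕ} {s : Subset.Subset n} {x : Fin n} → x Subset.∈ s → T (lookup s x)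
∈⇒T-lookup x∈s = Equivalence.from T-≡ ([]=⇒lookup x∈s)

T-lookup⇒∈ : {n : ℕ} (s : Subset.Subset n) {x : Fin n} → T (lookup s x) → x Subset.∈ s
T-lookup⇒∈ s t = lookup⇒[]= _ _ (Equivalence.to T-≡ t)

module _ {n : ℕ} (P : FinPoset n) where
  open FinPoset P using (le) renaming (refl to le-refl)

  allSubs-isEnumeration : IsEnumeration (allSubs P)
  allSubs-isEnumeration = allVecs-isEnumeration bools-isEnumeration n

  eqᵇ-refl : (x : Fin n) → T (eqᵇ P x x)
  eqᵇ-refl x = fromWitness refl

  leHeadᵇ : {m : ℕ} → Fin n → Vec (Fin n) m → Bool
  leHeadᵇ x []      = true
  leHeadᵇ x (y ∷ _) = le x y

  lastLeᵇ : {m : ℕ} → Vec (Fin n) m → Fin n → Bool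
  lastLeᵇ []           a = true
  lastLeᵇ (y ∷ [])     a = le y a
  lastLeᵇ (_ ∷ z ∷ zs) a = lastLeᵇ (z ∷ zs) a

  isMultichain-∷ : {m : ℕ} (x : Fin n) (xs : Vec (Fin n) m) →
                   isMultichain P (x ∷ xs) ≡ leHeadᵇ x xs ∧ isMultichain P xs
  isMultichain-∷ x []      = refl
  isMultichain-∷ x (_ ∷ _) = refl

  isMultichain-∷ʳ : {m : ℕ} (xs : Vec (Fin n) m) (a : Fin n) →
                    isMultichain P (xs ∷ʳ a) ≡ isMultichain P xs ∧ lastLeᵇ xs a
  isMultichain-∷ʳ []           a = refl
  isMultichain-∷ʳ (y ∷ [])     a = ∧-identityʳ (le y a)
  isMultichain-∷ʳ (y ∷ z ∷ zs) a =
    trans (cong (le y z ∧_) (isMultichain-∷ʳ (z ∷ zs) a)) (sym (∧-assoc (le y z) _ _))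

  lastLeᵇ-∷ʳ : {m : ℕ} (xs : Vec (Fin n) m) (b a : Fin n) → lastLeᵇ (xs ∷ʳ b) a ≡ le b a
  lastLeᵇ-∷ʳ []           b a = refl
  lastLeᵇ-∷ʳ (y ∷ [])     b a = refl
  lastLeᵇ-∷ʳ (y ∷ z ∷ zs) b a = lastLeᵇ-∷ʳ (z ∷ zs) b a

  vecHas-∷ʳ : {m : ℕ} (p : Fin n) (xs : Vec (Fin n) m) (a : Fin n) →
              vecHas P p (xs ∷ʳ a) ≡ vecHas P p xs ∨ eqᵇ P p a
  vecHas-∷ʳ p []       a = ∨-comm (eqᵇ P p a) false
  vecHas-∷ʳ p (y ∷ ys) a =
    trans (cong (eqᵇ P p y ∨_) (vecHas-∷ʳ p ys a)) (sym (∨-assoc (eqᵇ P p y) _ _))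

  eqᵇ-sym : (x y : Fin n) → eqᵇ P x y ≡ eqᵇ P y x
  eqᵇ-sym x y = isYes-⇔ sym sym (x ≟ᶠ y) (y ≟ᶠ x)

  isMultichain-replicate : (m : ℕ) (p : Fin n) → T (isMultichain P (replicate (suc m) p))
  isMultichain-replicate zero    p = _
  isMultichain-replicate (suc m) p = T-∧-intro (le-refl p) (isMultichain-replicate m p)

  multichainWeight-pos : (m : ℕ) (p : Fin n) → 0 < multichainWeight P (suc m) p
  multichainWeight-pos m p =
    filter-some (λ v → T? (isMultichain P v ∧ vecHas P p v))
      (lose (IsEnumeration.complete (allVecs-isEnumeration (allFin-isEnumeration n) (suc m)) constant)
            (T-∧-intro (isMultichain-replicate m p) (Equivalence.from T-∨ (inj₁ (eqᵇ-refl p)))))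
    where
      constant : Vec (Fin n) (suc m)
      constant = replicate (suc m) p

  subsetᵇ-intro : (s t : Sub P) → s Subset.⊆ t → T (subsetᵇ P s t)
  subsetᵇ-intro s t s⊆t = T-all-intro (λ x → not (mem P x s) ∨ mem P x t) (allFin n)
    (λ x → T-⇒-intro (∈⇒T-lookup ∘ s⊆t ∘ T-lookup⇒∈ s))

  subsetᵇ-elim : (s t : Sub P) → T (subsetᵇ P s t) → s Subset.⊆ t
  subsetᵇ-elim s t s⊆ᵇt {x} x∈s = T-lookup⇒∈ t (T-⇒-elim x∈s⇒x∈t (∈⇒T-lookup x∈s))
    where
      x∈s⇒x∈t : T (not (mem P x s) ∨ mem P x t)
      x∈s⇒x∈t = T-all-elim (λ y → not (mem P y s) ∨ mem P y t) s⊆ᵇt (∈-allFin x)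

  isChain-⁅⁆ : (p : Fin n) → T (isChain P ⁅ p ⁆)
  isChain-⁅⁆ p =
    T-all-intro _ (allFin n) λ x → T-all-intro _ (allFin n) λ y → T-⇒-intro (comparable x y)
    where
      comparable : ∀ x y → T (mem P x ⁅ p ⁆ ∧ mem P y ⁅ p ⁆) → T (le x y ∨ le y x)
      comparable x y x,y∈⁅p⁆ with Equivalence.to T-∧ x,y∈⁅p⁆
      ... | x∈ , y∈
        rewrite x∈⁅y⁆⇒x≡y p (T-lookup⇒∈ ⁅ p ⁆ x∈) | x∈⁅y⁆⇒x≡y p (T-lookup⇒∈ ⁅ p ⁆ y∈) =
        Equivalence.from T-∨ (inj₁ (le-refl p))

  -- A largest chain through p is a maximal chain: every chain containing it also passes
  -- through p, so it is not larger.
  maximalChainThrough : (p : Fin n) → Σ (Sub P) λ s → T (isMaximalChain P s ∧ mem P p s)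
  maximalChainThrough p = best , T-∧-intro (T-∧-intro best-chain maximal) p∈best
    where
      through : Sub P → Bool
      through s = isChain P s ∧ mem P p s

      score : Sub P → ℕ
      score s = if through s then suc ∣ s ∣ else 0

      score-through : ∀ s → T (through s) → score s ≡ suc ∣ s ∣
      score-through s t with through s
      ... | true  = refl
      ... | false = ⊥-elim t

      score-pos⇒through : ∀ s → 0 < score s → T (through s)
      score-pos⇒through s pos with through s
      ... | true  = _
      ... | false with () ← pos

      best : Sub P
      best = argmax score ⁅ p ⁆ (allSubs P)

      score-le-best : ∀ t → score t ≤ score best
      score-le-best t = All.lookup (f[xs]≤f[argmax] {f = score} ⁅ p ⁆ (allSubs P))
                                   (IsEnumeration.complete allSubs-isEnumeration t)

      best-through : T (through best)
      best-through = score-pos⇒through best (begin-strict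
        0              <⟨ s≤s z≤n ⟩
        suc ∣ ⁅ p ⁆ ∣  ≡⟨ score-through ⁅ p ⁆ ⁅p⁆-through ⟨
        score ⁅ p ⁆    ≤⟨ f[⊥]≤f[argmax] {f = score} ⁅ p ⁆ (allSubs P) ⟩
        score best     ∎)
        where
          open ≤-Reasoning
          ⁅p⁆-through : T (through ⁅ p ⁆)
          ⁅p⁆-through = T-∧-intro (isChain-⁅⁆ p) (∈⇒T-lookup (x∈⁅x⁆ p))

      best-chain : T (isChain P best)
      best-chain = proj₁ (Equivalence.to T-∧ best-through)

      p∈best : T (mem P p best)
      p∈best = proj₂ (Equivalence.to T-∧ best-through)

      contains⇒⊆ : ∀ t → T (isChain P t) → best Subset.⊆ t → t Subset.⊆ best
      contains⇒⊆ t t-chain best⊆t {x} x∈t with T? (mem P x best)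
      ... | yes x∈best = T-lookup⇒∈ best x∈best
      ... | no  x∉best = contradiction (score-le-best t) (<⇒≱ (begin-strict
        score best    ≡⟨ score-through best best-through ⟩
        suc ∣ best ∣  <⟨ s≤s (p⊂q⇒∣p∣<∣q∣ (best⊆t , x , x∈t , x∉best ∘ ∈⇒T-lookup)) ⟩
        suc ∣ t ∣     ≡⟨ score-through t t-through ⟨
        score t       ∎))
        where
          open ≤-Reasoning
          t-through : T (through t)
          t-through = T-∧-intro t-chain (∈⇒T-lookup (best⊆t (T-lookup⇒∈ best p∈best)))

      maximal : T (all (λ t → not (subsetᵇ P best t ∧ isChain P t) ∨ subsetᵇ P t best) (allSubs P))
      maximal = T-all-intro _ (allSubs P) λ t → T-⇒-intro λ best⊆t∧t-chain →
        let best⊆t , t-chain = Equivalence.to T-∧ best⊆t∧t-chain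
        in subsetᵇ-intro t best (contains⇒⊆ t t-chain (subsetᵇ-elim best t best⊆t))

  maxChainWeight-pos : (p : Fin n) → 0 < maxChainWeight P p
  maxChainWeight-pos p =
    filter-some (λ s → T? (isMaximalChain P s ∧ mem P p s))
      (lose (IsEnumeration.complete allSubs-isEnumeration (proj₁ chain)) (proj₂ chain))
    where
      chain : Σ (Sub P) λ s → T (isMaximalChain P s ∧ mem P p s)
      chain = maximalChainThrough p

module SelfDualPoset {n : ℕ} (P : FinPoset n) (selfDual : SelfDual P) where
  open FinPoset P using (le)

  φ↔ : Fin n ↔ Fin n
  φ↔ = proj₁ selfDual

  open Inverse φ↔ using () renaming (to to φ)
  open Reindex (allFin-isEnumeration n) φ↔

  le-φ : ∀ x y → le (φ x) (φ y) ≡ le y x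
  le-φ x y = sym (proj₂ selfDual y x)

  eqᵇ-φ : ∀ x y → eqᵇ P (φ x) (φ y) ≡ eqᵇ P x y
  eqᵇ-φ x y = isYes-⇔ φ-injective (cong φ) (φ x ≟ᶠ φ y) (x ≟ᶠ y)
    where
      φ-injective : φ x ≡ φ y → x ≡ y
      φ-injective = Injection.injective (↔⇒↣ φ↔)

  ltᵇ-φ : ∀ x y → ltᵇ P (φ x) (φ y) ≡ ltᵇ P y x
  ltᵇ-φ x y = cong₂ (λ a b → a ∧ not b) (le-φ x y) (trans (eqᵇ-φ x y) (eqᵇ-sym P x y))

  coversᵇ-φ : ∀ q p → coversᵇ P (φ q) (φ p) ≡ coversᵇ P p q
  coversᵇ-φ q p = cong₂ (λ a b → a ∧ not b) (ltᵇ-φ q p) (begin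
    any (λ r → ltᵇ P (φ q) r ∧ ltᵇ P r (φ p)) (allFin n)          ≡⟨ any-∘-to _ ⟨
    any (λ r → ltᵇ P (φ q) (φ r) ∧ ltᵇ P (φ r) (φ p)) (allFin n)  ≡⟨ any-cong (allFin n) between ⟩
    any (λ r → ltᵇ P p r ∧ ltᵇ P r q) (allFin n)                  ∎)
    where
      open ≡-Reasoning
      between : ∀ r → (ltᵇ P (φ q) (φ r) ∧ ltᵇ P (φ r) (φ p)) ≡ (ltᵇ P p r ∧ ltᵇ P r q)
      between r = trans (cong₂ _∧_ (ltᵇ-φ q r) (ltᵇ-φ r p)) (∧-comm (ltᵇ P r q) (ltᵇ P p r))

  downDeg-φ : ∀ p → downDeg P (φ p) ≡ upDeg P p
  downDeg-φ p = trans (sym (count-∘-to (λ q → coversᵇ P q (φ p))))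
                      (count-cong (allFin n) (λ q → coversᵇ-φ q p))

  weighted-downDeg≡upDeg : (w : Fin n → ℕ) → (∀ p → w (φ p) ≡ w p) →
    sumFin n (λ p → w p * downDeg P p) ≡ sumFin n (λ p → w p * upDeg P p)
  weighted-downDeg≡upDeg w w-φ = trans (sym (sum-map-∘-to _))
    (cong sum (map-cong (λ p → cong₂ _*_ (w-φ p) (downDeg-φ p)) (allFin n)))

  expectation-φ-invariant : {Δ : ℕ} → Regular P Δ →
    (w : Fin n → ℕ) → (∀ p → w (φ p) ≡ w p) → 0 < sumFin n w → expectation P w ≡ + Δ / 2
  expectation-φ-invariant {Δ} regular w w-φ pos = ratio≡/ D (sumFin n w) Δ 1 twice-D pos
    where
      D U : ℕ
      D = sumFin n (λ p → w p * downDeg P p)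
      U = sumFin n (λ p → w p * upDeg P p)

      degree : ∀ p → w p * downDeg P p + w p * upDeg P p ≡ w p * Δ
      degree p = trans (sym (*-distribˡ-+ (w p) _ _)) (cong (_*_ (w p)) (regular p))

      twice-D : D * 2 ≡ Δ * sumFin n w
      twice-D = begin
        D * 2                                                 ≡⟨ *-comm D 2 ⟩
        D + (D + 0)                                           ≡⟨ cong (_+_ D) (+-identityʳ D) ⟩
        D + D                                                 ≡⟨ cong (_+_ D) (weighted-downDeg≡upDeg w w-φ) ⟩
        D + U                                                 ≡⟨ sum-map-+ _ _ (allFin n) ⟨
        sumFin n (λ p → w p * downDeg P p + w p * upDeg P p)  ≡⟨ cong sum (map-cong degree (allFin n)) ⟩
        sumFin n (λ p → w p * Δ)                              ≡⟨ sum-map-*ʳ w Δ (allFin n) ⟩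
        sumFin n w * Δ                                        ≡⟨ *-comm _ Δ ⟩
        Δ * sumFin n w                                        ∎
        where open ≡-Reasoning

  dual↔ : {m : ℕ} → Vec (Fin n) m ↔ Vec (Fin n) m
  dual↔ = reverse↔ ↔-∘ map↔ φ↔

  dual : {m : ℕ} → Vec (Fin n) m → Vec (Fin n) m
  dual = Inverse.to dual↔

  dual-∷ : {m : ℕ} (x : Fin n) (xs : Vec (Fin n) m) → dual (x ∷ xs) ≡ dual xs ∷ʳ φ x
  dual-∷ x xs = reverse-∷ (φ x) (Vec.map φ xs)

  lastLeᵇ-dual : {m : ℕ} (x : Fin n) (xs : Vec (Fin n) m) →
                 lastLeᵇ P (dual xs) (φ x) ≡ leHeadᵇ P x xs
  lastLeᵇ-dual x []       = refl
  lastLeᵇ-dual x (y ∷ ys) = begin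
    lastLeᵇ P (dual (y ∷ ys)) (φ x)    ≡⟨ cong (λ v → lastLeᵇ P v (φ x)) (dual-∷ y ys) ⟩
    lastLeᵇ P (dual ys ∷ʳ φ y) (φ x)   ≡⟨ lastLeᵇ-∷ʳ P (dual ys) (φ y) (φ x) ⟩
    le (φ y) (φ x)                     ≡⟨ le-φ y x ⟩
    le x y                             ∎
    where open ≡-Reasoning

  isMultichain-dual : {m : ℕ} (v : Vec (Fin n) m) → isMultichain P (dual v) ≡ isMultichain P v
  isMultichain-dual []       = refl
  isMultichain-dual (x ∷ xs) = begin
    isMultichain P (dual (x ∷ xs))
      ≡⟨ cong (isMultichain P) (dual-∷ x xs) ⟩
    isMultichain P (dual xs ∷ʳ φ x)
      ≡⟨ isMultichain-∷ʳ P (dual xs) (φ x) ⟩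
    isMultichain P (dual xs) ∧ lastLeᵇ P (dual xs) (φ x)
      ≡⟨ cong₂ _∧_ (isMultichain-dual xs) (lastLeᵇ-dual x xs) ⟩
    isMultichain P xs ∧ leHeadᵇ P x xs
      ≡⟨ ∧-comm (isMultichain P xs) (leHeadᵇ P x xs) ⟩
    leHeadᵇ P x xs ∧ isMultichain P xs
      ≡⟨ isMultichain-∷ P x xs ⟨
    isMultichain P (x ∷ xs)
      ∎
    where open ≡-Reasoning

  vecHas-dual : {m : ℕ} (p : Fin n) (v : Vec (Fin n) m) → vecHas P (φ p) (dual v) ≡ vecHas P p v
  vecHas-dual p []       = refl
  vecHas-dual p (x ∷ xs) = begin
    vecHas P (φ p) (dual (x ∷ xs))                ≡⟨ cong (vecHas P (φ p)) (dual-∷ x xs) ⟩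
    vecHas P (φ p) (dual xs ∷ʳ φ x)               ≡⟨ vecHas-∷ʳ P (φ p) (dual xs) (φ x) ⟩
    vecHas P (φ p) (dual xs) ∨ eqᵇ P (φ p) (φ x)  ≡⟨ cong₂ _∨_ (vecHas-dual p xs) (eqᵇ-φ p x) ⟩
    vecHas P p xs ∨ eqᵇ P p x                     ≡⟨ ∨-comm (vecHas P p xs) (eqᵇ P p x) ⟩
    vecHas P p (x ∷ xs)                           ∎
    where open ≡-Reasoning

  multichainWeight-φ : (m : ℕ) (p : Fin n) → multichainWeight P m (φ p) ≡ multichainWeight P m p
  multichainWeight-φ m p =
    trans (sym (Reindex.count-∘-to (allVecs-isEnumeration (allFin-isEnumeration n) m) dual↔
                                   (λ v → isMultichain P v ∧ vecHas P (φ p) v)))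
          (count-cong (allVecs (allFin n) m)
                      (λ v → cong₂ _∧_ (isMultichain-dual v) (vecHas-dual p v)))

  image↔ : Sub P ↔ Sub P
  image↔ = permute↔ φ↔

  image : Sub P → Sub P
  image = Inverse.to image↔

  mem-image : ∀ x s → mem P (φ x) (image s) ≡ mem P x s
  mem-image x s = lookup-permute φ↔ s x

  isChain-image : ∀ s → isChain P (image s) ≡ isChain P s
  isChain-image s =
    trans (sym (all-∘-to _)) (all-cong (allFin n) λ x →
      trans (sym (all-∘-to _)) (all-cong (allFin n) λ y → comparable-image x y))
    where
      comparable-image : ∀ x y →
        (not (mem P (φ x) (image s) ∧ mem P (φ y) (image s)) ∨ (le (φ x) (φ y) ∨ le (φ y) (φ x)))
          ≡ (not (mem P x s ∧ mem P y s) ∨ (le x y ∨ le y x))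
      comparable-image x y rewrite mem-image x s | mem-image y s | le-φ x y | le-φ y x =
        cong (not (mem P x s ∧ mem P y s) ∨_) (∨-comm (le y x) (le x y))

  subsetᵇ-image : ∀ s t → subsetᵇ P (image s) (image t) ≡ subsetᵇ P s t
  subsetᵇ-image s t = trans (sym (all-∘-to _))
    (all-cong (allFin n) λ x → cong₂ (λ a b → not a ∨ b) (mem-image x s) (mem-image x t))

  isMaximalChain-image : ∀ s → isMaximalChain P (image s) ≡ isMaximalChain P s
  isMaximalChain-image s = cong₂ _∧_ (isChain-image s)
    (trans (sym (Reindex.all-∘-to (allSubs-isEnumeration P) image↔ _))
      (all-cong (allSubs P) λ t → cong₂ (λ a b → not a ∨ b)
        (cong₂ _∧_ (subsetᵇ-image s t) (isChain-image t)) (subsetᵇ-image t s)))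

  maxChainWeight-φ : (p : Fin n) → maxChainWeight P (φ p) ≡ maxChainWeight P p
  maxChainWeight-φ p =
    trans (sym (Reindex.count-∘-to (allSubs-isEnumeration P) image↔
                                   (λ s → isMaximalChain P s ∧ mem P (φ p) s)))
          (count-cong (allSubs P) (λ s → cong₂ _∧_ (isMaximalChain-image s) (mem-image p s)))

proposition2p21 : (k : ℕ) (P : FinPoset (suc k)) (Δ : ℕ) →
    SelfDual P → Regular P Δ →
    mCDE P × CDE P × EX P ≡ + Δ / 2 × EY P ≡ + Δ / 2
proposition2p21 k P Δ selfDual regular =
  (λ m m′ → trans (EXm-half m) (sym (EXm-half m′))) ,
  trans (EXm-half 0) (sym EY-half) ,
  EXm-half 0 ,
  EY-half
  where
    open SelfDualPoset P selfDual

    EXm-half : ∀ m → EXm P (suc m) ≡ + Δ / 2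
    EXm-half m = expectation-φ-invariant regular (multichainWeight P (suc m)) (multichainWeight-φ (suc m))
      (sumFin-pos (multichainWeight P (suc m)) zero (multichainWeight-pos P m zero))

    EY-half : EY P ≡ + Δ / 2
    EY-half = expectation-φ-invariant regular (maxChainWeight P) maxChainWeight-φ
      (sumFin-pos (maxChainWeight P) zero (maxChainWeight-pos P zero))
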